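{- Let $\tau$ be a finite relational signature, let $A\in\mathsf{FIN}(\tau)$, and let $\mathcal{C}$ be either $[A]_{\leftrightarrow}$ or $\mathrm{CSP}(A)$. Then the following are equivalent: (i) $\mathcal{C}$ is decided by an adaptive left unbounded query algorithm over $\mathbb{B}$; (ii) $\mathcal{C}$ is decided by a non-adaptive left $k$-query algorithm over $\mathbb{B}$ for some $k$.
   Context: $\mathsf{FIN}(\tau)$ is the class of finite relational structures of signature $\tau$ with non-empty domain. $B\to A$ means there is a homomorphism from $B$ to $A$; $[A]_{\leftrightarrow}=\{B: A\to B\text{ and }B\to A\}$ and $\mathrm{CSP}(A)=\{B: B\to A\}$. $\hom_{\mathbb{B}}(F,D)$ is $1$ if $F\to D$ and $0$ otherwise. A non-adaptive left $k$-query algorithm over $\mathbb{B}$ is a pair $((F_1,\dots,F_k),X)$ with $F_i\in\mathsf{FIN}(\tau)$ and $X\subseteq\{0,1\}^k$; it decides $\{D:(\hom_{\mathbb{B}}(F_i,D))_{i=1}^k\in X\}$. For a set $\Sigma$, $\Sigma^{<\omega}$ is the set of finite strings over $\Sigma$; a subtree is a prefix-closed subset, a leaf an element with no proper extension. An adaptive left unbounded query algorithm over $\mathbb{B}$ is a function $G:\mathcal{T}\to\mathsf{FIN}(\tau)\cup\{\mathsf{YES},\mathsf{NO}\}$ with $\mathcal{T}\subseteq\{0,1\}^{<\omega}$ a subtree and $G(\sigma)\in\{\mathsf{YES},\mathsf{NO}\}$ iff $\sigma$ is a leaf; its computation path on $D$ is the limit of $\sigma_0=\varepsilon$, $\sigma_{i+1}=\sigma_i$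 if $G(\sigma_i)\in\{\mathsf{YES},\mathsf{NO}\}$, else $\sigma_{i+1}=\sigma_i\bullet\hom_{\mathbb{B}}(G(\sigma_i),D)$; it is required to be total (finite path on every input) and decides $\{D:G(\text{path of }D)=\mathsf{YES}\}$. -}

module Defs where

open import Data.Nat using (ℕ; _<_)
open import Data.Fin using (Fin)
open import Data.Vec using (Vec; map; lookup)
open import Data.Bool using (Bool; true; false)
open import Data.List using (List; []; _∷_; _++_)
open import Data.Product using (Σ; ∃; _×_; _,_)
open import Relation.Binary.PropositionalEquality using (_≡_; _≢_)
open import Relation.Nullary using (¬_)
open import Data.Unit using (⊤)
open import Data.Empty using (⊥)
open import Function.Bundles using (_⇔_)

record Signature : Set where
  field
    nsym  : ℕ
    arity : Fin nsym → ℕ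
open Signature public

record Structure (τ : Signature) : Set where
  field
    size     : ℕ
    nonempty : 0 < size
    rel      : (R : Fin (nsym τ)) → Vec (Fin size) (arity τ R) → Bool
open Structure public

_⟶_ : {τ : Signature} → Structure τ → Structure τ → Set
_⟶_ {τ} B A =
  Σ (Fin (size B) → Fin (size A)) λ h →
    ∀ (R : Fin (nsym τ)) (t : Vec (Fin (size B)) (arity τ R)) →
      rel B R t ≡ true → rel A R (map h t) ≡ true

Class : Signature → Set₁
Class τ = Structure τ → Set

EquivClass : {τ : Signature} → Structure τ → Class τ
EquivClass A B = (A ⟶ B) × (B ⟶ A)

CSP : {τ : Signature} → Structure τ → Class τ
CSP A B = B ⟶ A

data Kind : Set where
  equivKind cspKind : Kind

classOf : {τ : Signature} → Kind → Structure τ → Class τ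
classOf equivKind A = EquivClass A
classOf cspKind   A = CSP A

-- b is the value hom_B(F,D) (true = 1, false = 0).
IsHomValue : {τ : Signature} → Structure τ → Structure τ → Bool → Set
IsHomValue F D b = (b ≡ true) ⇔ (F ⟶ D)

record NonAdaptive (τ : Signature) (k : ℕ) : Set where
  field
    queries : Fin k → Structure τ
    accept  : Vec Bool k → Bool
open NonAdaptive public

NADecides : {τ : Signature} {k : ℕ} → NonAdaptive τ k → Class τ → Set
NADecides {τ} {k} alg C =
  ∀ (D : Structure τ) →
    C D ⇔ (Σ (Vec Bool k) λ b →
             (∀ i → IsHomValue (queries alg i) D (lookup b i)) × (accept alg b ≡ true))

-- Adaptive left unbounded query algorithm.
-- Strings in {0,1}^{<ω} are lists of booleans; σ • b is σ ++ (b ∷ []).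
-- The subtree 𝒯 is the set of σ with label σ ≢ nothing-like `outside`.
data Label (τ : Signature) : Set where
  outside : Label τ                     -- σ ∉ 𝒯
  query   : Structure τ → Label τ
  YES NO  : Label τ

InTree : {τ : Signature} → (List Bool → Label τ) → List Bool → Set
InTree G σ = G σ ≢ outside

IsLeaf : {τ : Signature} → (List Bool → Label τ) → List Bool → Set
IsLeaf G σ = InTree G σ × (∀ b ρ → ¬ InTree G (σ ++ (b ∷ ρ)))

IsAnswer : {τ : Signature} → Label τ → Set
IsAnswer YES = ⊤
IsAnswer NO  = ⊤
IsAnswer _   = ⊥

record Adaptive (τ : Signature) : Set₁ where
  field
    G            : List Bool → Label τ
    prefixClosed : ∀ σ ρ → InTree G (σ ++ ρ) → InTree G σ
    leafIff      : ∀ σ → InTree G σ → (IsAnswer (G σ) ⇔ IsLeaf G σ)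
open Adaptive public

data OnPath {τ : Signature} (alg : Adaptive τ) (D : Structure τ) : List Bool → Set where
  start : InTree (G alg) [] → OnPath alg D []
  step  : ∀ {σ F b} → OnPath alg D σ → G alg σ ≡ query F → IsHomValue F D b →
          InTree (G alg) (σ ++ (b ∷ [])) → OnPath alg D (σ ++ (b ∷ []))

Total : {τ : Signature} → Adaptive τ → Set
Total {τ} alg = ∀ (D : Structure τ) → ∃ λ σ → OnPath alg D σ × IsLeaf (G alg) σ

ADecides : {τ : Signature} → Adaptive τ → Class τ → Set
ADecides {τ} alg C =
  ∀ (D : Structure τ) → C D ⇔ (∃ λ σ → OnPath alg D σ × (G alg σ ≡ YES))

-- (ii) ⇒ (i): a non-adaptive algorithm becomes the adaptive one that asks its k queries in order,
-- whatever the answers, and then consults X.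
--
-- (i) ⇒ (ii): A itself belongs to the class, so the run of the adaptive algorithm on A ends in YES;
-- let L be the list of (query, answer) pairs along that run. Every D that answers the queries of L
-- as A does follows the same run and is accepted. For [A]↔ the converse holds as well, since
-- hom-equivalent structures answer every query alike, so "D answers L as A does" is a non-adaptive
-- test. For CSP(A) replace D by the disjoint union D ⊕ A, which maps to A iff D does and answers
-- every positive query of L correctly. A negative query F (F ↛ A) is answered correctly by D ⊕ A
-- unless F splits into a part mapping to D and a part mapping to A; as there are finitely many
-- splittings of F, this amounts to finitely many structures that must not map to D (plus one-point
-- structures checking that the nullary facts of D hold in A).
module Submission where

open import Defs
open import Data.Bool using (Bool; true; false; _∧_; _∨_; not; if_then_else_)
open import Data.Bool.Properties using (∧-conicalˡ; ∧-conicalʳ; ∨-zeroʳ; not-injective)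
  renaming (_≟_ to _≟ᵇ_)
open import Data.Empty using (⊥-elim)
open import Data.Fin using (Fin; zero; suc; splitAt; _↑ˡ_; _↑ʳ_; fromℕ<; finToFun; funToFin)
open import Data.Fin.Properties using (all?; any?; finToFun-funToFin; splitAt-↑ˡ; splitAt-↑ʳ)
  renaming (_≟_ to _≟ᶠ_)
open import Data.Fin.Subset using (Subset)
open import Data.List as List
  using (List; []; _∷_; _++_; [_]; _∷ʳ_; length; concatMap; filter; allFin; cartesianProductWith)
open import Data.List.Membership.Propositional using (_∈_; find)
open import Data.List.Membership.Propositional.Properties
  using (∈-map⁺; ∈-map⁻; ∈-++⁺ˡ; ∈-++⁺ʳ; ∈-++⁻; ∈-concatMap⁺; ∈-concatMap⁻; ∈-filter⁺; ∈-filter⁻;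
         ∈-allFin; ∈-cartesianProductWith⁺; ∈-lookup)
open import Data.List.Relation.Unary.All as All using (All)
open import Data.List.Relation.Unary.All.Properties using (map⁺; map⁻)
open import Data.List.Relation.Unary.Any as Any using (here; there)
open import Data.List.Reverse using (Reverse; []; _∶_∶ʳ_; reverseView)
open import Data.Nat as ℕ using (ℕ; _+_; s≤s; z≤n)
open import Data.Nat.Properties using (<-≤-trans; m≤m+n)
open import Data.Product as Product using (Σ; ∃; _×_; _,_; proj₁; proj₂)
open import Data.Sum using (_⊎_; inj₁; inj₂; [_,_]′; fromInj₁; fromInj₂)
open import Data.Unit using (⊤; tt)
open import Data.Vec using (Vec; []; _∷_; map; lookup; tabulate; toList)
open import Data.Vec.Properties
  using (≡-dec; map-cong; map-∘; map-id; lookup∘tabulate; tabulate∘lookup; tabulate-cong)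
open import Function using (_∘_; id; const)
open import Function.Bundles using (_⇔_; mk⇔; Equivalence)
import Function.Properties.Equivalence as ⇔
open import Level using (Level)
open import Relation.Binary.PropositionalEquality
  using (_≡_; _≢_; refl; sym; trans; cong; cong₂; subst; _≗_)
open import Relation.Nullary using (Dec; yes; no; ¬_; does; contradiction)
open import Relation.Nullary.Decidable using (map′; _×-dec_; _→-dec_; ¬?; dec-true)

open Equivalence

private variable
  ℓ₁ ℓ₂ : Level
  A : Set ℓ₁
  B : Set ℓ₂
  n : ℕ

does⇔ : ∀ {p} {P : Set p} (P? : Dec P) → (does P? ≡ true) ⇔ P
does⇔ (yes p) = mk⇔ (λ _ → p) (λ _ → refl)
does⇔ (no ¬p) = mk⇔ (λ ()) (λ p → ⊥-elim (¬p p))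

∃-function? : ∀ {m n p} {P : (Fin m → Fin n) → Set p} →
              (∀ {f g} → f ≗ g → P f → P g) → (∀ f → Dec (P f)) → Dec (∃ P)
∃-function? resp P? =
  map′ (λ (i , p) → finToFun i , p)
       (λ (f , p) → funToFin f , resp (sym ∘ finToFun-funToFin f) p)
       (any? (P? ∘ finToFun))

∀-tuple? : ∀ {m n p} {P : Vec (Fin n) m → Set p} → (∀ t → Dec (P t)) → Dec (∀ t → P t)
∀-tuple? {P = P} P? =
  map′ (λ ∀P t → subst P (tabulate-finToFun t) (∀P (funToFin (lookup t))))
       (λ ∀P _ → ∀P _)
       (all? (P? ∘ tabulate ∘ finToFun))
  where
  tabulate-finToFun : ∀ t → tabulate (finToFun (funToFin (lookup t))) ≡ t
  tabulate-finToFun t = trans (tabulate-cong (finToFun-funToFin (lookup t))) (tabulate∘lookup t)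

∨-true⁻ : ∀ x {y} → x ∨ y ≡ true → x ≡ true ⊎ y ≡ true
∨-true⁻ true  _ = inj₁ refl
∨-true⁻ false y = inj₂ y

∨-trueˡ : ∀ {x} y → x ≡ true → x ∨ y ≡ true
∨-trueˡ y x≡true = cong (_∨ y) x≡true

∨-trueʳ : ∀ x {y} → y ≡ true → x ∨ y ≡ true
∨-trueʳ x y≡true = trans (cong (x ∨_) y≡true) (∨-zeroʳ x)

all : (A → Bool) → Vec A n → Bool
all p []      = true
all p (x ∷ t) = p x ∧ all p t

nonEmpty : Vec A n → Bool
nonEmpty []      = false
nonEmpty (_ ∷ _) = true

all-true : {p : A → Bool} → (∀ x → p x ≡ true) → (t : Vec A n) → all p t ≡ true
all-true p-true []      = refl
all-true p-true (x ∷ t) = cong₂ _∧_ (p-true x) (all-true p-true t)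

all-cong : {p q : A → Bool} → p ≗ q → (t : Vec A n) → all p t ≡ all q t
all-cong p≗q []      = refl
all-cong p≗q (x ∷ t) = cong₂ _∧_ (p≗q x) (all-cong p≗q t)

all-map : (p : B → Bool) (f : A → B) (t : Vec A n) → all p (map f t) ≡ all (p ∘ f) t
all-map p f []      = refl
all-map p f (x ∷ t) = cong (p (f x) ∧_) (all-map p f t)

all∧none⇒empty : {p : A → Bool} (t : Vec A n) →
                 all p t ≡ true → all (not ∘ p) t ≡ true → nonEmpty t ≡ false
all∧none⇒empty                 []      _     _     = refl
all∧none⇒empty {p = p} (x ∷ t) all-p all-¬p with p x
... | true  = sym all-¬p
... | false = sym all-p

nonEmpty-length : (t : Vec A n) (u : Vec B n) → nonEmpty t ≡ nonEmpty u
nonEmpty-length []      []      = refl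
nonEmpty-length (_ ∷ _) (_ ∷ _) = refl

empty-unique : (t u : Vec A n) → nonEmpty t ≡ false → t ≡ u
empty-unique [] [] _ = refl

map-cong-all : {f g : A → B} (p : A → Bool) → (∀ x → p x ≡ true → f x ≡ g x) →
               (t : Vec A n) → all p t ≡ true → map f t ≡ map g t
map-cong-all p f≡g []      _     = refl
map-cong-all p f≡g (x ∷ t) all-p =
  cong₂ _∷_ (f≡g x (∧-conicalˡ _ _ all-p)) (map-cong-all p f≡g t (∧-conicalʳ _ _ all-p))

map-retraction : {f : A → B} {g : B → A} → (∀ x → g (f x) ≡ x) → (t : Vec A n) →
                 map g (map f t) ≡ t
map-retraction {f = f} {g} gf≡id t =
  trans (sym (map-∘ g f t)) (trans (map-cong gf≡id t) (map-id t))

All-fromLookup : {P : A → Set ℓ₂} (xs : List A) → (∀ i → P (List.lookup xs i)) → All P xs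
All-fromLookup []       _ = All.[]
All-fromLookup (x ∷ xs) p = p zero All.∷ All-fromLookup xs (p ∘ suc)

allSubsets : ∀ n → List (Subset n)
allSubsets ℕ.zero    = [ [] ]
allSubsets (ℕ.suc n) = cartesianProductWith _∷_ (true ∷ false ∷ []) (allSubsets n)

∈-allSubsets : (S : Subset n) → S ∈ allSubsets n
∈-allSubsets []      = here refl
∈-allSubsets (b ∷ S) = ∈-cartesianProductWith⁺ _∷_ (∈-booleans b) (∈-allSubsets S)
  where
  ∈-booleans : ∀ b → b ∈ true ∷ false ∷ []
  ∈-booleans true  = here refl
  ∈-booleans false = there (here refl)

module _ {τ : Signature} where

  IsHom : (B A : Structure τ) → (Fin (size B) → Fin (size A)) → Set
  IsHom B A h = ∀ R t → rel B R t ≡ true → rel A R (map h t) ≡ true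

  IsHom-resp-≗ : {B A : Structure τ} {h g : Fin (size B) → Fin (size A)} →
                 h ≗ g → IsHom B A h → IsHom B A g
  IsHom-resp-≗ {A = A} h≗g h-hom R t r =
    subst (λ u → rel A R u ≡ true) (map-cong h≗g t) (h-hom R t r)

  ∀-fact? : (X : Structure τ) {P : ∀ R → Vec (Fin (size X)) (arity τ R) → Set} →
            (∀ R t → Dec (P R t)) → Dec (∀ R t → rel X R t ≡ true → P R t)
  ∀-fact? X P? = all? λ R → ∀-tuple? λ t → (rel X R t ≟ᵇ true) →-dec P? R t

  _⟶?_ : (B A : Structure τ) → Dec (B ⟶ A)
  B ⟶? A = ∃-function? (IsHom-resp-≗ {B} {A}) λ h → ∀-fact? B λ R t → rel A R (map h t) ≟ᵇ true

  ⟶-refl : {A : Structure τ} → A ⟶ A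
  ⟶-refl {A} = id , λ R t r → subst (λ u → rel A R u ≡ true) (sym (map-id t)) r

  ⟶-trans : {A B C : Structure τ} → A ⟶ B → B ⟶ C → A ⟶ C
  ⟶-trans {C = C} (f , f-hom) (g , g-hom) = g ∘ f , λ R t r →
    subst (λ u → rel C R u ≡ true) (sym (map-∘ g f t)) (g-hom R (map f t) (f-hom R t r))

  IsHomValue-false : {F D : Structure τ} → IsHomValue F D false ⇔ (¬ (F ⟶ D))
  IsHomValue-false = mk⇔ (λ v F⟶D → contradiction (from v F⟶D) λ ())
                         (λ F↛D → mk⇔ (λ ()) (⊥-elim ∘ F↛D))

  Literal : Set
  Literal = Structure τ × Bool

  _⊨_ : Structure τ → Literal → Set
  D ⊨ (F , b) = IsHomValue F D b

  ⊨-transfer : {A D : Structure τ} {ℓ : Literal} → A ⟶ D → D ⟶ A → A ⊨ ℓ → D ⊨ ℓ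
  ⊨-transfer {A} {D} {F , _} A⟶D D⟶A v =
    mk⇔ (λ b≡true → ⟶-trans {F} {A} {D} (to v b≡true) A⟶D)
        (λ F⟶D → from v (⟶-trans {F} {D} {A} F⟶D D⟶A))

  expectedAnswers : (L : List Literal) → Vec Bool (length L)
  expectedAnswers L = tabulate (proj₂ ∘ List.lookup L)

  literalAlgorithm : (L : List Literal) → NonAdaptive τ (length L)
  literalAlgorithm L = record
    { queries = proj₁ ∘ List.lookup L
    ; accept  = λ b → does (≡-dec _≟ᵇ_ b (expectedAnswers L))
    }

  literalAlgorithm-decides : ∀ {C} L → (∀ D → C D ⇔ All (D ⊨_) L) → NADecides (literalAlgorithm L) C
  literalAlgorithm-decides L C⇔L D = mk⇔
    (λ c → expected , to Correct-expected⇔ (to (C⇔L D) c) , dec-true (≡-dec _≟ᵇ_ expected expected) refl)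
    (λ (b , b-correct , accepted) → from (C⇔L D) (from Correct-expected⇔
      (subst Correct (to (does⇔ (≡-dec _≟ᵇ_ b expected)) accepted) b-correct)))
    where
    expected = expectedAnswers L
    Q = queries (literalAlgorithm L)

    Correct : Vec Bool (length L) → Set
    Correct b = ∀ i → IsHomValue (Q i) D (lookup b i)

    Correct-expected⇔ : All (D ⊨_) L ⇔ Correct expected
    Correct-expected⇔ = mk⇔
      (λ sat i → subst (IsHomValue (Q i) D) (sym (lookup∘tabulate _ i)) (All.lookup sat (∈-lookup i)))
      (λ correct → All-fromLookup L λ i → subst (IsHomValue (Q i) D) (lookup∘tabulate _ i) (correct i))

  -- Runs of adaptive algorithms

  Consistent : (List Bool → Label τ) → Structure τ → List Bool → Set
  Consistent tree D []      = ⊤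
  Consistent tree D (b ∷ σ) =
    (∃ λ F → tree [] ≡ query F × IsHomValue F D b) × Consistent (tree ∘ (b ∷_)) D σ

  Consistent-∷ʳ : ∀ {tree D F b} σ → Consistent tree D σ → tree σ ≡ query F → IsHomValue F D b →
                  Consistent tree D (σ ∷ʳ b)
  Consistent-∷ʳ []      _              tree≡ v = (_ , tree≡ , v) , tt
  Consistent-∷ʳ (_ ∷ σ) (first , rest) tree≡ v = first , Consistent-∷ʳ σ rest tree≡ v

  Consistent-∷ʳ⁻ : ∀ {tree D b} σ → Consistent tree D (σ ∷ʳ b) →
                   Consistent tree D σ × ∃ λ F → tree σ ≡ query F × IsHomValue F D b
  Consistent-∷ʳ⁻ []      (last , _)     = tt , last
  Consistent-∷ʳ⁻ (_ ∷ σ) (first , rest) = Product.map₁ (first ,_) (Consistent-∷ʳ⁻ σ rest)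

  module _ (alg : Adaptive τ) where

    OnPath⇒Consistent : ∀ {D σ} → OnPath alg D σ → Consistent (G alg) D σ
    OnPath⇒Consistent (start _)           = tt
    OnPath⇒Consistent (step {σ} p G≡ v _) = Consistent-∷ʳ σ (OnPath⇒Consistent p) G≡ v

    Consistent⇒OnPath : ∀ {D σ} → InTree (G alg) σ → Consistent (G alg) D σ → OnPath alg D σ
    Consistent⇒OnPath {σ = σ} = go (reverseView σ)
      where
      go : ∀ {D σ} → Reverse σ → InTree (G alg) σ → Consistent (G alg) D σ → OnPath alg D σ
      go []           σ∈  _ = start σ∈
      go (σ ∶ r ∶ʳ b) σb∈ c with Consistent-∷ʳ⁻ σ c
      ... | c′ , _ , G≡ , v = step (go r (prefixClosed alg σ [ b ] σb∈) c′) G≡ v σb∈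

    transcript : ∀ {X σ} → OnPath alg X σ → List Literal
    transcript (start _)                      = []
    transcript (step {F = F} {b = b} p _ _ _) = (F , b) ∷ transcript p

    ⊨-transcript : ∀ {X σ} (p : OnPath alg X σ) → All (X ⊨_) (transcript p)
    ⊨-transcript (start _)      = All.[]
    ⊨-transcript (step p _ v _) = v All.∷ ⊨-transcript p

    OnPath-transfer : ∀ {X Y σ} (p : OnPath alg X σ) → All (Y ⊨_) (transcript p) → OnPath alg Y σ
    OnPath-transfer (start σ∈)       _             = start σ∈
    OnPath-transfer (step p G≡ _ σ∈) (v All.∷ sat) = step (OnPath-transfer p sat) G≡ v σ∈

    accepts-transcript : ∀ {C A Y σ} → ADecides alg C → (p : OnPath alg A σ) → G alg σ ≡ YES →
                         All (Y ⊨_) (transcript p) → C Y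
    accepts-transcript {Y = Y} {σ} decides p σ-yes sat =
      from (decides Y) (σ , OnPath-transfer p sat , σ-yes)

  -- The query tree of a non-adaptive algorithm

  answer≢outside : ∀ {l : Label τ} → IsAnswer l → l ≢ outside
  answer≢outside l-answer refl = l-answer

  verdict : Bool → Label τ
  verdict true  = YES
  verdict false = NO

  verdict-isAnswer : ∀ b → IsAnswer (verdict b)
  verdict-isAnswer true  = tt
  verdict-isAnswer false = tt

  verdict-YES : ∀ {b} → verdict b ≡ YES → b ≡ true
  verdict-YES {true} _ = refl

  queryTree : ∀ {k} → (Fin k → Structure τ) → (Vec Bool k → Bool) → List Bool → Label τ
  queryTree {ℕ.zero}  Q X []      = verdict (X [])
  queryTree {ℕ.zero}  Q X (_ ∷ _) = outside
  queryTree {ℕ.suc k} Q X []      = query (Q zero)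
  queryTree {ℕ.suc k} Q X (b ∷ σ) = queryTree (Q ∘ suc) (X ∘ (b ∷_)) σ

  queryTree-root : ∀ {k} Q X → InTree (queryTree {k} Q X) []
  queryTree-root {ℕ.zero}  Q X = answer≢outside (verdict-isAnswer (X []))
  queryTree-root {ℕ.suc k} Q X ()

  queryTree-prefixClosed : ∀ {k} Q X σ ρ →
                           InTree (queryTree {k} Q X) (σ ++ ρ) → InTree (queryTree Q X) σ
  queryTree-prefixClosed            Q X []      ρ _   = queryTree-root Q X
  queryTree-prefixClosed {ℕ.zero}  Q X (_ ∷ _) ρ σρ∈ = σρ∈
  queryTree-prefixClosed {ℕ.suc k} Q X (b ∷ σ) ρ σρ∈ =
    queryTree-prefixClosed (Q ∘ suc) (X ∘ (b ∷_)) σ ρ σρ∈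

  queryTree-leafIff : ∀ {k} Q X σ → InTree (queryTree {k} Q X) σ →
                      IsAnswer (queryTree Q X σ) ⇔ IsLeaf (queryTree Q X) σ
  queryTree-leafIff {ℕ.zero}  Q X []      σ∈ =
    mk⇔ (λ _ → σ∈ , λ _ _ child∈ → child∈ refl) (λ _ → verdict-isAnswer (X []))
  queryTree-leafIff {ℕ.zero}  Q X (_ ∷ _) σ∈ = ⊥-elim (σ∈ refl)
  queryTree-leafIff {ℕ.suc k} Q X []      _  = mk⇔ (λ ())
    (λ (_ , childless) → ⊥-elim (childless false [] (queryTree-root (Q ∘ suc) (X ∘ (false ∷_)))))
  queryTree-leafIff {ℕ.suc k} Q X (b ∷ σ) σ∈ = queryTree-leafIff (Q ∘ suc) (X ∘ (b ∷_)) σ σ∈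

  queryTree-toList : ∀ {k} Q X (b : Vec Bool k) → queryTree Q X (toList b) ≡ verdict (X b)
  queryTree-toList Q X []      = refl
  queryTree-toList Q X (c ∷ b) = queryTree-toList (Q ∘ suc) (X ∘ (c ∷_)) b

  Consistent-toList : ∀ {k} Q X {D} (b : Vec Bool k) → (∀ i → IsHomValue (Q i) D (lookup b i)) →
                      Consistent (queryTree Q X) D (toList b)
  Consistent-toList Q X []      _       = tt
  Consistent-toList Q X (c ∷ b) correct =
    (Q zero , refl , correct zero) , Consistent-toList (Q ∘ suc) (X ∘ (c ∷_)) b (correct ∘ suc)

  Consistent-YES : ∀ {k} Q X {D} σ → Consistent (queryTree {k} Q X) D σ → queryTree Q X σ ≡ YES →
                   ∃ λ b → (∀ i → IsHomValue (Q i) D (lookup b i)) × X b ≡ true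
  Consistent-YES {ℕ.zero}  Q X []      _ σ-yes = [] , (λ ()) , verdict-YES σ-yes
  Consistent-YES {ℕ.suc k} Q X (c ∷ σ) ((_ , refl , v) , rest) σ-yes
    with Consistent-YES (Q ∘ suc) (X ∘ (c ∷_)) σ rest σ-yes
  ... | b , correct , accepted = c ∷ b , (λ { zero → v ; (suc i) → correct i }) , accepted

  queryTreeAlgorithm : ∀ {k} → NonAdaptive τ k → Adaptive τ
  queryTreeAlgorithm A = record
    { G            = queryTree (queries A) (accept A)
    ; prefixClosed = queryTree-prefixClosed (queries A) (accept A)
    ; leafIff      = queryTree-leafIff (queries A) (accept A)
    }

  module _ {k} (A : NonAdaptive τ k) where

    private
      Q = queries A
      X = accept A

    answers : Structure τ → Vec Bool k
    answers D = tabulate λ i → does (Q i ⟶? D)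

    answers-correct : ∀ D i → IsHomValue (Q i) D (lookup (answers D) i)
    answers-correct D i = subst (IsHomValue (Q i) D) (sym (lookup∘tabulate _ i)) (does⇔ (Q i ⟶? D))

    toList-isAnswer : ∀ b → IsAnswer (queryTree Q X (toList b))
    toList-isAnswer b = subst IsAnswer (sym (queryTree-toList Q X b)) (verdict-isAnswer (X b))

    OnPath-toList : ∀ {D} b → (∀ i → IsHomValue (Q i) D (lookup b i)) →
                    OnPath (queryTreeAlgorithm A) D (toList b)
    OnPath-toList b correct = Consistent⇒OnPath (queryTreeAlgorithm A)
      (answer≢outside (toList-isAnswer b)) (Consistent-toList Q X b correct)

    queryTree-total : Total (queryTreeAlgorithm A)
    queryTree-total D = toList b , OnPath-toList b (answers-correct D) ,
      to (queryTree-leafIff Q X (toList b) (answer≢outside (toList-isAnswer b))) (toList-isAnswer b)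
      where
      b = answers D

    queryTree-decides : ∀ {C} → NADecides A C → ADecides (queryTreeAlgorithm A) C
    queryTree-decides decides D = mk⇔
      (λ c → let (b , correct , accepted) = to (decides D) c in
        toList b , OnPath-toList b correct , trans (queryTree-toList Q X b) (cong verdict accepted))
      (λ (σ , p , σ-yes) → from (decides D) (Consistent-YES Q X σ (OnPath⇒Consistent _ p) σ-yes))

  -- Splittings and disjoint unions

  infix 25 _↾_

  _↾_ : (F : Structure τ) → (∀ {k} → Vec (Fin (size F)) k → Bool) → Structure τ
  F ↾ P = record { size = size F ; nonempty = nonempty F ; rel = λ R t → rel F R t ∧ P t }

  -- The empty tuple never lies within S: nullary facts of F always go to the part avoiding S.
  within avoids : ∀ {m k} → Subset m → Vec (Fin m) k → Bool
  within S t = nonEmpty t ∧ all (lookup S) t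
  avoids S t = all (not ∘ lookup S) t

  Separates : (F : Structure τ) → Subset (size F) → Set
  Separates F S = ∀ R t → rel F R t ≡ true → within S t ∨ avoids S t ≡ true

  Separates? : ∀ F S → Dec (Separates F S)
  Separates? F S = ∀-fact? F λ R t → within S t ∨ avoids S t ≟ᵇ true

  glue : ∀ {F X : Structure τ} {S} → Separates F S → F ↾ within S ⟶ X → F ↾ avoids S ⟶ X → F ⟶ X
  glue {F} {X} {S} separates (g₁ , g₁-hom) (g₂ , g₂-hom) = g , g-hom
    where
    g : Fin (size F) → Fin (size X)
    g x = if lookup S x then g₁ x else g₂ x

    g≡g₁ : ∀ x → lookup S x ≡ true → g x ≡ g₁ x
    g≡g₁ x x∈S = cong (if_then g₁ x else g₂ x) x∈S

    g≡g₂ : ∀ x → not (lookup S x) ≡ true → g x ≡ g₂ x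
    g≡g₂ x x∉S = cong (if_then g₁ x else g₂ x) (not-injective x∉S)

    g-hom : IsHom F X g
    g-hom R t r with ∨-true⁻ (within S t) (separates R t r)
    ... | inj₁ t-within = subst (λ u → rel X R u ≡ true)
      (sym (map-cong-all (lookup S) g≡g₁ t (∧-conicalʳ _ _ t-within)))
      (g₁-hom R t (cong₂ _∧_ r t-within))
    ... | inj₂ t-avoids = subst (λ u → rel X R u ≡ true)
      (sym (map-cong-all (not ∘ lookup S) g≡g₂ t t-avoids))
      (g₂-hom R t (cong₂ _∧_ r t-avoids))

  point : Fin (nsym τ) → Structure τ
  point R = record
    { size = 1 ; nonempty = s≤s z≤n ; rel = λ R′ t → does (R′ ≟ᶠ R) ∧ not (nonEmpty t) }

  point⟶⇔ : ∀ {X R} (t : Vec (Fin (size X)) (arity τ R)) → nonEmpty t ≡ false →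
            point R ⟶ X ⇔ rel X R t ≡ true
  point⟶⇔ {X} {R} t t-empty = mk⇔ to′ from′
    where
    to′ : point R ⟶ X → rel X R t ≡ true
    to′ (g , g-hom) = subst (λ u → rel X R u ≡ true) (empty-unique _ t empty)
      (g-hom R (map (const zero) t) (cong₂ _∧_ (dec-true (R ≟ᶠ R) refl) (cong not empty)))
      where
      empty : ∀ {C : Set} {u : Vec C (arity τ R)} → nonEmpty u ≡ false
      empty {u = u} = trans (nonEmpty-length u t) t-empty

    from′ : rel X R t ≡ true → point R ⟶ X
    from′ r = const (fromℕ< (nonempty X)) , hom
      where
      hom : IsHom (point R) X (const (fromℕ< (nonempty X)))
      hom R′ t′ r′ with R′ ≟ᶠ R
      ... | yes refl = subst (λ u → rel X R u ≡ true) (empty-unique t _ t-empty) r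

  module _ (B C : Structure τ) where

    isLeft : Fin (size B + size C) → Bool
    isLeft = [ const true , const false ]′ ∘ splitAt (size B)

    -- toLeft and toRight send the other summand to an arbitrary element; they are only
    -- applied to tuples lying in a single summand.
    toLeft : Fin (size B + size C) → Fin (size B)
    toLeft = fromInj₁ (const (fromℕ< (nonempty B))) ∘ splitAt (size B)

    toRight : Fin (size B + size C) → Fin (size C)
    toRight = fromInj₂ (const (fromℕ< (nonempty C))) ∘ splitAt (size B)

    isLeft-↑ˡ : ∀ x → isLeft (x ↑ˡ size C) ≡ true
    isLeft-↑ˡ x = cong [ const true , const false ]′ (splitAt-↑ˡ (size B) x (size C))

    toLeft-↑ˡ : ∀ x → toLeft (x ↑ˡ size C) ≡ x
    toLeft-↑ˡ x = cong (fromInj₁ _) (splitAt-↑ˡ (size B) x (size C))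

    isRight-↑ʳ : ∀ y → not (isLeft (size B ↑ʳ y)) ≡ true
    isRight-↑ʳ y = cong (not ∘ [ const true , const false ]′) (splitAt-↑ʳ (size B) (size C) y)

    toRight-↑ʳ : ∀ y → toRight (size B ↑ʳ y) ≡ y
    toRight-↑ʳ y = cong (fromInj₂ _) (splitAt-↑ʳ (size B) (size C) y)

  infixr 30 _⊕_

  _⊕_ : Structure τ → Structure τ → Structure τ
  B ⊕ C = record
    { size     = size B + size C
    ; nonempty = <-≤-trans (nonempty B) (m≤m+n (size B) (size C))
    ; rel      = λ R w → (all (isLeft B C) w ∧ rel B R (map (toLeft B C) w))
                       ∨ (all (not ∘ isLeft B C) w ∧ rel C R (map (toRight B C) w))
    }

  module _ {B C : Structure τ} where

    ⊕-inj₁ : B ⟶ B ⊕ C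
    ⊕-inj₁ = (_↑ˡ size C) , λ R t r → ∨-trueˡ _ (cong₂ _∧_
      (trans (all-map _ _ t) (all-true (isLeft-↑ˡ B C) t))
      (subst (λ u → rel B R u ≡ true) (sym (map-retraction (toLeft-↑ˡ B C) t)) r))

    ⊕-inj₂ : C ⟶ B ⊕ C
    ⊕-inj₂ = (size B ↑ʳ_) , λ R t r → ∨-trueʳ _ (cong₂ _∧_
      (trans (all-map _ _ t) (all-true (isRight-↑ʳ B C) t))
      (subst (λ u → rel C R u ≡ true) (sym (map-retraction (toRight-↑ʳ B C) t)) r))

    module LeftPreimage {F : Structure τ} (F⟶B⊕C : F ⟶ B ⊕ C) where

      private
        h : Fin (size F) → Fin (size B + size C)
        h = proj₁ F⟶B⊕C

        h-hom : IsHom F (B ⊕ C) h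
        h-hom = proj₂ F⟶B⊕C

      leftPreimage : Subset (size F)
      leftPreimage = tabulate (isLeft B C ∘ h)

      private
        S : Subset (size F)
        S = leftPreimage

        all-S : ∀ {k} (t : Vec (Fin (size F)) k) → all (lookup S) t ≡ all (isLeft B C) (map h t)
        all-S t = trans (all-cong (lookup∘tabulate _) t) (sym (all-map _ h t))

        all-∁S : ∀ {k} (t : Vec (Fin (size F)) k) → avoids S t ≡ all (not ∘ isLeft B C) (map h t)
        all-∁S t = trans (all-cong (cong not ∘ lookup∘tabulate _) t) (sym (all-map _ h t))

        sides : ∀ {k} (t : Vec (Fin (size F)) k) {x y} →
                (all (isLeft B C) (map h t) ∧ x) ∨ (all (not ∘ isLeft B C) (map h t) ∧ y) ≡ true →
                within S t ∨ avoids S t ≡ true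
        sides []            _ = refl
        sides t@(_ ∷ _) {x} e with ∨-true⁻ _ e
        ... | inj₁ left  = ∨-trueˡ _ (trans (all-S t) (∧-conicalˡ _ x left))
        ... | inj₂ right = ∨-trueʳ _ (trans (all-∁S t) (∧-conicalˡ _ _ right))

      separates : Separates F leftPreimage
      separates R t r = sides t (h-hom R t r)

      within⟶ : F ↾ within leftPreimage ⟶ B
      within⟶ = toLeft B C ∘ h , hom
        where
        hom : IsHom (F ↾ within S) B (toLeft B C ∘ h)
        hom R t r with ∨-true⁻ _ (h-hom R t (∧-conicalˡ _ _ r))
        ... | inj₁ left  = subst (λ u → rel B R u ≡ true) (sym (map-∘ _ h t)) (∧-conicalʳ _ _ left)
        ... | inj₂ right =
          contradiction (trans (sym non-empty) (trans (nonEmpty-length t (map h t)) empty)) λ ()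
          where
          t-within  = ∧-conicalʳ (rel F R t) _ r
          non-empty = ∧-conicalˡ _ _ t-within
          empty     = all∧none⇒empty (map h t)
            (trans (sym (all-S t)) (∧-conicalʳ _ _ t-within)) (∧-conicalˡ _ _ right)

      avoids⟶ : (∀ R → point R ⟶ B → point R ⟶ C) → F ↾ avoids leftPreimage ⟶ C
      avoids⟶ nullary-B⊆C = toRight B C ∘ h , hom
        where
        hom : IsHom (F ↾ avoids S) C (toRight B C ∘ h)
        hom R t r with ∨-true⁻ _ (h-hom R t (∧-conicalˡ _ _ r))
        ... | inj₂ right = subst (λ u → rel C R u ≡ true) (sym (map-∘ _ h t)) (∧-conicalʳ _ _ right)
        ... | inj₁ left  =
          to (point⟶⇔ {C} (map (toRight B C ∘ h) t) (trans (nonEmpty-length _ (map h t)) empty))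
             (nullary-B⊆C R (from (point⟶⇔ {B} (map (toLeft B C) (map h t))
                                                (trans (nonEmpty-length _ _) empty))
                                   (∧-conicalʳ _ _ left)))
          where
          empty = all∧none⇒empty (map h t)
            (∧-conicalˡ _ _ left) (trans (sym (all-∁S t)) (∧-conicalʳ _ _ r))

  -- Obstructions for CSP(A)

  GoodSplit : Structure τ → (F : Structure τ) → Subset (size F) → Set
  GoodSplit A F S = Separates F S × (F ↾ avoids S ⟶ A)

  goodSplit? : ∀ A F S → Dec (GoodSplit A F S)
  goodSplit? A F S = Separates? F S ×-dec (F ↾ avoids S ⟶? A)

  splitObstructions : Structure τ → Literal → List (Structure τ)
  splitObstructions A (F , true)  = []
  splitObstructions A (F , false) =
    List.map (λ S → F ↾ within S) (filter (goodSplit? A F) (allSubsets (size F)))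

  pointObstructions : Structure τ → List (Structure τ)
  pointObstructions A = List.map point (filter (λ R → ¬? (point R ⟶? A)) (allFin (nsym τ)))

  obstructions : Structure τ → List Literal → List (Structure τ)
  obstructions A L = pointObstructions A ++ concatMap (splitObstructions A) L

  splitObstruction↛ : ∀ {A O} ℓ → A ⊨ ℓ → O ∈ splitObstructions A ℓ → ¬ (O ⟶ A)
  splitObstruction↛ {A} (F , false) F↛A O∈ O⟶A with ∈-map⁻ _ O∈
  ... | S , S∈ , refl with proj₂ (∈-filter⁻ (goodSplit? A F) {xs = allSubsets (size F)} S∈)
  ...   | separates , avoids⟶A =
    to (IsHomValue-false {F} {A}) F↛A (glue {F} {A} {S} separates O⟶A avoids⟶A)

  obstruction↛ : ∀ {A O L} → All (A ⊨_) L → O ∈ obstructions A L → ¬ (O ⟶ A)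
  obstruction↛ {A} {O} {L} A⊨L O∈ with ∈-++⁻ (pointObstructions A) O∈
  ... | inj₁ O∈points with ∈-map⁻ point O∈points
  ...   | R , R∈ , refl = proj₂ (∈-filter⁻ (λ R → ¬? (point R ⟶? A)) {xs = allFin (nsym τ)} R∈)
  obstruction↛ {A} {O} {L} A⊨L O∈ | inj₂ O∈splits
    with find (∈-concatMap⁻ (splitObstructions A) {xs = L} O∈splits)
  ... | ℓ , ℓ∈L , O∈ℓ = splitObstruction↛ ℓ (All.lookup A⊨L ℓ∈L) O∈ℓ

  ∈-obstructions : ∀ {A L F S} → (F , false) ∈ L → GoodSplit A F S → F ↾ within S ∈ obstructions A L
  ∈-obstructions {A} {L} {F} {S} F∈L good =
    ∈-++⁺ʳ (pointObstructions A) (∈-concatMap⁺ (splitObstructions A) {xs = L} (Any.map F∈split F∈L))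
    where
    F∈split : ∀ {ℓ} → (F , false) ≡ ℓ → F ↾ within S ∈ splitObstructions A ℓ
    F∈split refl = ∈-map⁺ _ (∈-filter⁺ (goodSplit? A F) (∈-allSubsets S) good)

  module _ {A : Structure τ} {L : List Literal} (A⊨L : All (A ⊨_) L) where

    CSP⇒unobstructed : ∀ {D} → CSP A D → All (λ O → ¬ (O ⟶ D)) (obstructions A L)
    CSP⇒unobstructed {D} D⟶A =
      All.tabulate λ {O} O∈ O⟶D → obstruction↛ A⊨L O∈ (⟶-trans {O} {D} {A} O⟶D D⟶A)

    unobstructed⇒⊕⊨ : ∀ {D} → All (λ O → ¬ (O ⟶ D)) (obstructions A L) → All ((D ⊕ A) ⊨_) L
    unobstructed⇒⊕⊨ {D} unobstructed = All.tabulate λ {ℓ} ℓ∈L → satisfies ℓ ℓ∈L (All.lookup A⊨L ℓ∈L)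
      where
      nullary-D⊆A : ∀ R → point R ⟶ D → point R ⟶ A
      nullary-D⊆A R R⟶D with point R ⟶? A
      ... | yes R⟶A = R⟶A
      ... | no  R↛A = ⊥-elim (All.lookup unobstructed
        (∈-++⁺ˡ (∈-map⁺ point (∈-filter⁺ (λ R → ¬? (point R ⟶? A)) (∈-allFin R) R↛A))) R⟶D)

      unsplittable : ∀ F → (F , false) ∈ L → ¬ (F ⟶ D ⊕ A)
      unsplittable F F∈L F⟶D⊕A = All.lookup unobstructed
        (∈-obstructions {A} {L} {F} {leftPreimage} F∈L (separates , avoids⟶ nullary-D⊆A)) within⟶
        where
        open LeftPreimage {D} {A} {F} F⟶D⊕A

      satisfies : ∀ ℓ → ℓ ∈ L → A ⊨ ℓ → (D ⊕ A) ⊨ ℓ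
      satisfies (F , true)  _    F⟶A =
        mk⇔ (λ _ → ⟶-trans {F} {A} {D ⊕ A} (to F⟶A refl) (⊕-inj₂ {D} {A})) (λ _ → refl)
      satisfies (F , false) F∈L _   = from (IsHomValue-false {F} {D ⊕ A}) (unsplittable F F∈L)

  unobstructed⇔⊨ : ∀ {D} Os → All (λ O → ¬ (O ⟶ D)) Os ⇔ All (D ⊨_) (List.map (_, false) Os)
  unobstructed⇔⊨ {D} Os = mk⇔
    (map⁺ ∘ All.map λ {O} → from (IsHomValue-false {O} {D}))
    (All.map (λ {O} → to (IsHomValue-false {O} {D})) ∘ map⁻)

  CSP⇔unobstructed : ∀ {alg A σ} → ADecides alg (CSP A) → (p : OnPath alg A σ) → G alg σ ≡ YES →
                     ∀ D → CSP A D ⇔ All (λ O → ¬ (O ⟶ D)) (obstructions A (transcript alg p))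
  CSP⇔unobstructed {alg} {A} decides p σ-yes D =
    mk⇔ (CSP⇒unobstructed (⊨-transcript alg p) {D}) λ unobstructed →
      ⟶-trans {D} {D ⊕ A} {A} (⊕-inj₁ {D} {A})
        (accepts-transcript alg {Y = D ⊕ A} decides p σ-yes
          (unobstructed⇒⊕⊨ (⊨-transcript alg p) {D} unobstructed))

  EquivClass⇔⊨transcript : ∀ {alg A σ} → ADecides alg (EquivClass A) → (p : OnPath alg A σ) →
                           G alg σ ≡ YES → ∀ D → EquivClass A D ⇔ All (D ⊨_) (transcript alg p)
  EquivClass⇔⊨transcript {alg} {A} decides p σ-yes D = mk⇔
    (λ (A⟶D , D⟶A) → All.map (λ {ℓ} → ⊨-transfer {A} {D} {ℓ} A⟶D D⟶A) (⊨-transcript alg p))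
    (accepts-transcript alg {Y = D} decides p σ-yes)

  literalDescription : ∀ κ {alg A σ} → ADecides alg (classOf κ A) → (p : OnPath alg A σ) →
                       G alg σ ≡ YES → ∃ λ L → ∀ D → classOf κ A D ⇔ All (D ⊨_) L
  literalDescription equivKind {alg} decides p σ-yes =
    transcript alg p , EquivClass⇔⊨transcript decides p σ-yes
  literalDescription cspKind {alg} {A} decides p σ-yes =
    List.map (_, false) Os , λ D → ⇔.trans (CSP⇔unobstructed decides p σ-yes D) (unobstructed⇔⊨ {D} Os)
    where
    Os = obstructions A (transcript alg p)

  classOf-refl : ∀ κ (A : Structure τ) → classOf κ A A
  classOf-refl equivKind A = ⟶-refl {A} , ⟶-refl {A}
  classOf-refl cspKind   A = ⟶-refl {A}

theorem25 : (τ : Signature) (A : Structure τ) (κ : Kind) →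
    (Σ (Adaptive τ) λ alg → Total alg × ADecides alg (classOf κ A))
      ⇔ (∃ λ (k : ℕ) → Σ (NonAdaptive τ k) λ alg → NADecides alg (classOf κ A))
theorem25 τ A κ = mk⇔
  (λ (alg , _ , decides) →
    let (_ , p , σ-yes) = to (decides A) (classOf-refl κ A)
        (L , C⇔L)       = literalDescription κ decides p σ-yes
    in length L , literalAlgorithm L , literalAlgorithm-decides L C⇔L)
  (λ (_ , na , decides) → queryTreeAlgorithm na , queryTree-total na , queryTree-decides na decides)
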